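{- Let $G=(V,E)$ be a digraph and $\mathsf{in},\mathsf{out}:V\to\mathbb{Z}_{\ge 0}$. Then $(G,\mathsf{in},\mathsf{out})$ is a yes-instance of \textsc{Decision Unweighted Fixed Degree Connected Subgraph} if and only if the bipartite graph $B_G$ contains a connected perfect matching.
   Context: \textsc{Decision Unweighted Fixed Degree Connected Subgraph}: given $G$ (no multiple edges, single loops allowed) and $\mathsf{in},\mathsf{out}$, decide whether there is $m:V^2\to\mathbb{Z}_{\ge 0}$ such that the digraph on $V$ with edge set $\{(u,v): m(u,v)>0\}$ is a subgraph of $G$ whose underlying undirected graph is connected, and $\sum_u m(u,v)=\mathsf{in}(v)$, $\sum_u m(v,u)=\mathsf{out}(v)$ for all $v$. The undirected bipartite graph $B_G$ has sides $O=\{v^O_i : v\in V,\ 1\le i\le\mathsf{out}(v)\}$ and $I=\{v^I_j : v\in V,\ 1\le j\le \mathsf{in}(v)\}$ and edge set $\{u^O_iv^I_j : (u,v)\in E(G)\}$. A matching $M$ in $B_G$ is connected if for every $X$ with $\emptyset\neq X\subsetneq V$, $M$ contains an edge $u^O_iv^I_j$ with exactly one of $u,v$ in $X$. -}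

module Defs where

open import Data.Nat using (ℕ; zero; suc; _+_)
open import Data.Fin using (Fin)
open import Data.Fin.Subset using (Subset; _∈_; _∉_; Nonempty)
open import Data.Product using (Σ; ∃; _×_; _,_; proj₁)
open import Data.Sum using (_⊎_)
open import Data.Vec.Functional using (foldr)
open import Relation.Binary.PropositionalEquality using (_≡_)
open import Relation.Nullary using (¬_)
open import Level using (0ℓ)

-- A digraph on vertex set V = Fin n: an edge relation (at most one edge
-- from u to v, single loops (v,v) allowed).
Digraph : ℕ → Set₁
Digraph n = Fin n → Fin n → Set

Σ[_] : ∀ {n} → (Fin n → ℕ) → ℕ
Σ[ f ] = foldr _+_ 0 f

data Reach {n} (H : Digraph n) : Fin n → Fin n → Set where
  here : ∀ {u} → Reach H u u
  fwd  : ∀ {u v w} → H u v → Reach H v w → Reach H u w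
  bwd  : ∀ {u v w} → H v u → Reach H v w → Reach H u w

UConnected : ∀ {n} → Digraph n → Set
UConnected H = ∀ u v → Reach H u v

Support : ∀ {n} → (Fin n → Fin n → ℕ) → Digraph n
Support m u v = ¬ (m u v ≡ 0)

YesInstance : ∀ {n} → Digraph n → (Fin n → ℕ) → (Fin n → ℕ) → Set
YesInstance {n} G inn out =
  Σ (Fin n → Fin n → ℕ) λ m →
    (∀ u v → Support m u v → G u v) ×
    UConnected (Support m) ×
    (∀ v → Σ[ (λ u → m u v) ] ≡ inn v) ×
    (∀ v → Σ[ (λ u → m v u) ] ≡ out v)

-- The bipartite graph B_G.
-- O-side vertices v^O_i : pairs (v , i) with i < out(v).
OVert : ∀ {n} → (Fin n → ℕ) → Set
OVert {n} out = Σ (Fin n) λ v → Fin (out v)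

-- I-side vertices v^I_j : pairs (v , j) with j < in(v).
IVert : ∀ {n} → (Fin n → ℕ) → Set
IVert {n} inn = Σ (Fin n) λ v → Fin (inn v)

BEdge : ∀ {n} (G : Digraph n) (inn out : Fin n → ℕ) → OVert out → IVert inn → Set
BEdge G inn out o i = G (proj₁ o) (proj₁ i)

record PerfectMatching {n} (G : Digraph n) (inn out : Fin n → ℕ) : Set₁ where
  field
    M        : OVert out → IVert inn → Set
    inB      : ∀ o i → M o i → BEdge G inn out o i
    uniqueI  : ∀ o i i′ → M o i → M o i′ → i ≡ i′
    uniqueO  : ∀ o o′ i → M o i → M o′ i → o ≡ o′
    coverO   : ∀ o → ∃ λ i → M o i
    coverI   : ∀ i → ∃ λ o → M o i

Crosses : ∀ {n} → Subset n → Fin n → Fin n → Set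
Crosses X u v = (u ∈ X × v ∉ X) ⊎ (u ∉ X × v ∈ X)

ConnectedMatching : ∀ {n} {G : Digraph n} {inn out : Fin n → ℕ} →
                    PerfectMatching G inn out → Set
ConnectedMatching {n} {G} {inn} {out} PM =
  ∀ (X : Subset n) → Nonempty X → (∃ λ w → w ∉ X) →
    Σ (OVert out) λ o → Σ (IVert inn) λ i →
      PerfectMatching.M PM o i × Crosses X (proj₁ o) (proj₁ i)

HasConnectedPerfectMatching : ∀ {n} → Digraph n → (Fin n → ℕ) → (Fin n → ℕ) → Set₁
HasConnectedPerfectMatching G inn out =
  Σ (PerfectMatching G inn out) ConnectedMatching

module Submission where

-- Both sides of the equivalence describe m(u,v) copies of each edge (u,v).
--  * A perfect matching of B_G is the graph of a bijection F : O ↔ I sending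
--    each u^O_i to a copy v^I_j of an out-neighbour v of u.
--  * Given F, m(u,v) = #{k : F(u^O_k) lies over v} has the right degrees,
--    since iterated sums over O and I are invariant under F (proved by
--    flattening Σ (Fin n) (Fin ∘ h) onto Fin (Σ h) and permuting).
--  * Given m, both O and I are in bijection with the set of edge copies
--    Σ u v. Fin (m u v), by splitting out(u) = Σ_v m(u,v) and
--    in(v) = Σ_u m(u,v); composing the two gives F.
--  * A digraph is weakly connected iff every cut ∅ ≠ X ⊊ V is crossed by an
--    edge, and crossing edges of the matching and of the support of m
--    correspond to each other.

open import Defs
open import Algebra.Properties.CommutativeMonoid.Sum as Sum using ()
open import Data.Empty using (⊥-elim)
open import Data.Fin using (Fin; zero; suc; _↑ˡ_; _↑ʳ_; splitAt; join; fromℕ<; _≟_)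
open import Data.Fin.Permutation using (Permutation)
open import Data.Fin.Properties
  using (splitAt-↑ˡ; splitAt-↑ʳ; join-splitAt; ¬∀⟶∃¬; ¬Fin0; suc-injective)
open import Data.Fin.Subset using (Subset; _∈_; _∉_; Nonempty; ⁅_⁆; _∪_; ∣_∣)
open import Data.Fin.Subset.Properties
  using (_∈?_; x∈⁅x⁆; x∈⁅y⁆⇒x≡y; x∈p∪q⁻; p⊆p∪q; q⊆p∪q; p⊂q⇒∣p∣<∣q∣; ∣p∣≤n; ∣p∣≡n⇒p≡⊤; ∈⊤)
open import Data.Nat using (ℕ; zero; suc; _+_; _≤_)
import Data.Nat as ℕ
open import Data.Nat.Properties
  using (+-0-commutativeMonoid; +-identityʳ; +-assoc; +-suc; m+n≡0⇒m≡0; m+n≡0⇒n≡0; 1+n≢0;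
         n≢0⇒n>0; ≤-antisym; ≤-trans; ≤-reflexive; +-monoʳ-≤; m≤m+n)
open import Data.Product using (Σ; ∃; _×_; _,_; proj₁; proj₂)
open import Data.Product.Properties using (∃∃↔∃∃)
open import Data.Sum using (inj₁; inj₂; [_,_]′)
open import Function using (_∘_)
open import Function.Bundles using (_⇔_; mk⇔; _↔_; Inverse; mk↔ₛ′)
open import Function.Properties.Inverse using (↔-trans; ↔-sym)
open import Relation.Binary.PropositionalEquality
open import Relation.Nullary using (¬_; yes; no)

open Inverse using (to; from; strictlyInverseˡ; strictlyInverseʳ)
open Sum +-0-commutativeMonoid using (sum-cong-≗; sum-replicate-zero; ∑-comm; sum-permute)

Σ-zeros : ∀ {n} (f : Fin n → ℕ) → (∀ i → f i ≡ 0) → Σ[ f ] ≡ 0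
Σ-zeros {n} f z = trans (sum-cong-≗ z) (sum-replicate-zero n)

Σ-ones : ∀ k → Σ[ (λ (_ : Fin k) → 1) ] ≡ k
Σ-ones zero    = refl
Σ-ones (suc k) = cong suc (Σ-ones k)

Σ≡0⇒term≡0 : ∀ {n} (f : Fin n → ℕ) → Σ[ f ] ≡ 0 → ∀ j → f j ≡ 0
Σ≡0⇒term≡0 f s zero    = m+n≡0⇒m≡0 (f zero) s
Σ≡0⇒term≡0 f s (suc j) = Σ≡0⇒term≡0 (f ∘ suc) (m+n≡0⇒n≡0 (f zero) s) j

Σ≢0⇒term≢0 : ∀ {n} (f : Fin n → ℕ) → ¬ Σ[ f ] ≡ 0 → ∃ λ j → ¬ f j ≡ 0
Σ≢0⇒term≢0 {n} f s = ¬∀⟶∃¬ n (λ j → f j ≡ 0) (λ j → f j ℕ.≟ 0) (s ∘ Σ-zeros f)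

Σ-single : ∀ {n} (f : Fin n → ℕ) v → (∀ w → w ≢ v → f w ≡ 0) → Σ[ f ] ≡ f v
Σ-single f zero vanish = begin
  f zero + Σ[ f ∘ suc ] ≡⟨ cong (f zero +_) (Σ-zeros (f ∘ suc) (λ w → vanish (suc w) λ ())) ⟩
  f zero + 0            ≡⟨ +-identityʳ (f zero) ⟩
  f zero                ∎
  where open ≡-Reasoning
Σ-single f (suc v) vanish =
  cong₂ _+_ (vanish zero λ ()) (Σ-single (f ∘ suc) v (λ w w≢v → vanish (suc w) (w≢v ∘ suc-injective)))

Σ-++ : ∀ a b (g : Fin (a + b) → ℕ) → Σ[ g ] ≡ Σ[ (λ i → g (i ↑ˡ b)) ] + Σ[ (λ j → g (a ↑ʳ j)) ]
Σ-++ zero    b g = refl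
Σ-++ (suc a) b g = trans (cong (g zero +_) (Σ-++ a b (g ∘ suc))) (sym (+-assoc (g zero) _ _))

-- Kronecker delta on Fin n; summing it counts the copies lying over a vertex.
δ : ∀ {n} → Fin n → Fin n → ℕ
δ w v with w ≟ v
... | yes _ = 1
... | no  _ = 0

δ-diag : ∀ {n} (v : Fin n) → δ v v ≡ 1
δ-diag v with v ≟ v
... | yes _   = refl
... | no  v≢v = ⊥-elim (v≢v refl)

δ-off : ∀ {n} {w v : Fin n} → w ≢ v → δ w v ≡ 0
δ-off {w = w} {v} w≢v with w ≟ v
... | yes w≡v = ⊥-elim (w≢v w≡v)
... | no  _   = refl

δ≢0⇒≡ : ∀ {n} (w v : Fin n) → ¬ δ w v ≡ 0 → w ≡ v
δ≢0⇒≡ w v δ≢0 with w ≟ v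
... | yes w≡v = w≡v
... | no  _   = ⊥-elim (δ≢0 refl)

Σ-δ-row : ∀ {n} (w : Fin n) → Σ[ δ w ] ≡ 1
Σ-δ-row w = trans (Σ-single (δ w) w (λ v v≢w → δ-off (v≢w ∘ sym))) (δ-diag w)

Copies : ∀ {n} → (Fin n → ℕ) → Set
Copies {n} h = Σ (Fin n) (λ u → Fin (h u))

ΣΣ[_] : ∀ {n} (h : Fin n → ℕ) → (Copies h → ℕ) → ℕ
ΣΣ[ h ] c = Σ[ (λ u → Σ[ (λ k → c (u , k)) ]) ]

ΣΣ-cong : ∀ {n} (h : Fin n → ℕ) {c d : Copies h → ℕ} → (∀ x → c x ≡ d x) → ΣΣ[ h ] c ≡ ΣΣ[ h ] d
ΣΣ-cong h c≗d = sum-cong-≗ (λ u → sum-cong-≗ (λ k → c≗d (u , k)))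

flat : ∀ {n} (h : Fin n → ℕ) → Copies h → Fin Σ[ h ]
flat h (zero  , k) = k ↑ˡ Σ[ h ∘ suc ]
flat h (suc u , k) = h zero ↑ʳ flat (h ∘ suc) (u , k)

unflat : ∀ {n} (h : Fin n → ℕ) → Fin Σ[ h ] → Copies h
unflat {suc n} h x =
  [ (zero ,_) , (λ (u , k) → suc u , k) ∘ unflat (h ∘ suc) ]′ (splitAt (h zero) x)

unflat-flat : ∀ {n} (h : Fin n → ℕ) x → unflat h (flat h x) ≡ x
unflat-flat h (zero , k) rewrite splitAt-↑ˡ (h zero) k Σ[ h ∘ suc ] = refl
unflat-flat h (suc u , k)
  rewrite splitAt-↑ʳ (h zero) Σ[ h ∘ suc ] (flat (h ∘ suc) (u , k))
        | unflat-flat (h ∘ suc) (u , k) = refl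

flat-unflat : ∀ {n} (h : Fin n → ℕ) x → flat h (unflat h x) ≡ x
flat-unflat {suc n} h x with splitAt (h zero) x in eq
... | inj₁ k = trans (cong (join (h zero) _) (sym eq)) (join-splitAt (h zero) _ x)
... | inj₂ y = trans (cong (h zero ↑ʳ_) (flat-unflat (h ∘ suc) y))
                     (trans (cong (join (h zero) _) (sym eq)) (join-splitAt (h zero) _ x))

flatten : ∀ {n} (h : Fin n → ℕ) → Fin Σ[ h ] ↔ Copies h
flatten h = mk↔ₛ′ (unflat h) (flat h) (unflat-flat h) (flat-unflat h)

Σ-blocks : ∀ {n} (h : Fin n → ℕ) (g : Fin Σ[ h ] → ℕ) → Σ[ g ] ≡ ΣΣ[ h ] (g ∘ flat h)
Σ-blocks {zero}  h g = refl
Σ-blocks {suc n} h g = trans (Σ-++ (h zero) Σ[ h ∘ suc ] g)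
  (cong (Σ[ (λ k → g (k ↑ˡ Σ[ h ∘ suc ])) ] +_) (Σ-blocks (h ∘ suc) (g ∘ (h zero ↑ʳ_))))

Σ-flatten : ∀ {n} (h : Fin n → ℕ) (c : Copies h → ℕ) → Σ[ c ∘ to (flatten h) ] ≡ ΣΣ[ h ] c
Σ-flatten h c = trans (Σ-blocks h (c ∘ to (flatten h)))
                      (ΣΣ-cong h (cong c ∘ strictlyInverseˡ (flatten h)))

flattenTo : ∀ {n} {h : Fin n → ℕ} {k} → Σ[ h ] ≡ k → Fin k ↔ Copies h
flattenTo {h = h} Σh≡k = subst (λ k → Fin k ↔ Copies h) Σh≡k (flatten h)

ΣΣ-bijection : ∀ {n n′} (h : Fin n → ℕ) (g : Fin n′ → ℕ) (F : Copies h ↔ Copies g) (c : Copies g → ℕ) →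
               ΣΣ[ h ] (c ∘ to F) ≡ ΣΣ[ g ] c
ΣΣ-bijection h g F c = begin
  ΣΣ[ h ] (c ∘ to F)                ≡⟨ Σ-flatten h (c ∘ to F) ⟨
  Σ[ c ∘ to F ∘ to (flatten h) ]    ≡⟨ sum-cong-≗ (cong c ∘ strictlyInverseˡ (flatten g) ∘ to F ∘ to (flatten h)) ⟨
  Σ[ c ∘ to (flatten g) ∘ to π ]    ≡⟨ sum-permute (c ∘ to (flatten g)) π ⟨
  Σ[ c ∘ to (flatten g) ]           ≡⟨ Σ-flatten g c ⟩
  ΣΣ[ g ] c                         ∎
  where
  open ≡-Reasoning
  π : Permutation Σ[ h ] Σ[ g ]
  π = ↔-trans (flatten h) (↔-trans F (↔-sym (flatten g)))

ΣΣ-δ : ∀ {n} (h : Fin n → ℕ) (v : Fin n) → ΣΣ[ h ] (λ x → δ (proj₁ x) v) ≡ h v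
ΣΣ-δ h v = begin
  ΣΣ[ h ] (λ x → δ (proj₁ x) v)       ≡⟨ Σ-single (λ w → Σ[ (λ (_ : Fin (h w)) → δ w v) ]) v
                                            (λ w w≢v → Σ-zeros (λ (_ : Fin (h w)) → δ w v) (λ _ → δ-off w≢v)) ⟩
  Σ[ (λ (_ : Fin (h v)) → δ v v) ]     ≡⟨ sum-cong-≗ {h v} (λ _ → δ-diag v) ⟩
  Σ[ (λ (_ : Fin (h v)) → 1) ]         ≡⟨ Σ-ones (h v) ⟩
  h v                                  ∎
  where open ≡-Reasoning

CutsCrossed : ∀ {n} → Digraph n → Set
CutsCrossed {n} H = ∀ (X : Subset n) → Nonempty X → (∃ λ w → w ∉ X) →
  Σ (Fin n) λ u → Σ (Fin n) λ v → H u v × Crosses X u v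

walk-crosses : ∀ {n} {H : Digraph n} (X : Subset n) {a b} → Reach H a b → a ∈ X → b ∉ X →
  Σ (Fin n) λ u → Σ (Fin n) λ v → H u v × Crosses X u v
walk-crosses X here a∈X a∉X = ⊥-elim (a∉X a∈X)
walk-crosses X (fwd {u} {v} h r) u∈X b∉X with v ∈? X
... | yes v∈X = walk-crosses X r v∈X b∉X
... | no  v∉X = u , v , h , inj₁ (u∈X , v∉X)
walk-crosses X (bwd {u} {v} h r) u∈X b∉X with v ∈? X
... | yes v∈X = walk-crosses X r v∈X b∉X
... | no  v∉X = v , u , h , inj₂ (v∉X , u∈X)

connected⇒cutsCrossed : ∀ {n} {H : Digraph n} → UConnected H → CutsCrossed H
connected⇒cutsCrossed conn X (a , a∈X) (b , b∉X) = walk-crosses X (conn a b) a∈X b∉X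

insert-grows : ∀ {n} (X : Subset n) {y} → y ∉ X → suc ∣ X ∣ ≤ ∣ ⁅ y ⁆ ∪ X ∣
insert-grows X {y} y∉X = p⊂q⇒∣p∣<∣q∣ (q⊆p∪q ⁅ y ⁆ X , y , p⊆p∪q X (x∈⁅x⁆ y) , y∉X)

-- For the converse, grow a set X of vertices that all reach a root r: as
-- long as X misses a vertex, the outer end of an edge crossing X is a new
-- vertex reaching r, and after n steps X is everything.
module _ {n} {H : Digraph n} (crossed : CutsCrossed H) (r : Fin n) where

  Reaching : Subset n → Set
  Reaching X = ∀ x → x ∈ X → Reach H x r

  new-reaching : ∀ X → Nonempty X → Reaching X → (∃ λ w → w ∉ X) →
                 ∃ λ y → y ∉ X × Reach H y r
  new-reaching X ne reach missed with crossed X ne missed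
  ... | u , v , h , inj₁ (u∈X , v∉X) = v , v∉X , bwd h (reach u u∈X)
  ... | u , v , h , inj₂ (u∉X , v∈X) = u , u∉X , fwd h (reach v v∈X)

  insert-reaching : ∀ X y → Reaching X → Reach H y r → Reaching (⁅ y ⁆ ∪ X)
  insert-reaching X y reach y→r x x∈yX with x∈p∪q⁻ ⁅ y ⁆ X x∈yX
  ... | inj₁ x∈y = subst (λ z → Reach H z r) (sym (x∈⁅y⁆⇒x≡y y x∈y)) y→r
  ... | inj₂ x∈X = reach x x∈X

  spread : ∀ d X → n ≤ d + ∣ X ∣ → r ∈ X → Reaching X → ∀ b → Reach H b r
  spread d X bound r∈X reach b with b ∈? X
  ... | yes b∈X = reach b b∈X
  spread zero X bound r∈X reach b | no b∉X =
    ⊥-elim (b∉X (subst (b ∈_) (sym (∣p∣≡n⇒p≡⊤ (≤-antisym (∣p∣≤n X) bound))) (∈⊤ {n})))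
  spread (suc d) X bound r∈X reach b | no b∉X with new-reaching X (r , r∈X) reach (b , b∉X)
  ... | y , y∉X , y→r =
    spread d (⁅ y ⁆ ∪ X) bound′ (q⊆p∪q ⁅ y ⁆ X r∈X) (insert-reaching X y reach y→r) b
    where
    bound′ : n ≤ d + ∣ ⁅ y ⁆ ∪ X ∣
    bound′ = ≤-trans bound (≤-trans (≤-reflexive (sym (+-suc d ∣ X ∣)))
                                    (+-monoʳ-≤ d (insert-grows X y∉X)))

cutsCrossed⇒connected : ∀ {n} {H : Digraph n} → CutsCrossed H → UConnected H
cutsCrossed⇒connected {n} {H} crossed u v =
  spread crossed v n ⁅ v ⁆ (m≤m+n n ∣ ⁅ v ⁆ ∣) (x∈⁅x⁆ v) reaches-v u
  where
  reaches-v : Reaching crossed v ⁅ v ⁆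
  reaches-v x x∈v = subst (λ z → Reach H z v) (sym (x∈⁅y⁆⇒x≡y v x∈v)) here

module _ {n} {G : Digraph n} {inn out : Fin n → ℕ} where

  AlongG : (OVert out ↔ IVert inn) → Set
  AlongG F = ∀ o → G (proj₁ o) (proj₁ (to F o))

  graphMatching : (F : OVert out ↔ IVert inn) → AlongG F → PerfectMatching G inn out
  graphMatching F along = record
    { M       = λ o i → to F o ≡ i
    ; inB     = λ o i Fo≡i → subst (λ i → G (proj₁ o) (proj₁ i)) Fo≡i (along o)
    ; uniqueI = λ o i i′ Fo≡i Fo≡i′ → trans (sym Fo≡i) Fo≡i′
    ; uniqueO = λ o o′ i Fo≡i Fo′≡i →
        trans (sym (strictlyInverseʳ F o)) (trans (cong (from F) (trans Fo≡i (sym Fo′≡i)))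
                                                  (strictlyInverseʳ F o′))
    ; coverO  = λ o → to F o , refl
    ; coverI  = λ i → from F i , strictlyInverseˡ F i
    }

  module _ (PM : PerfectMatching G inn out) where
    open PerfectMatching PM

    partner : OVert out ↔ IVert inn
    partner = mk↔ₛ′ (proj₁ ∘ coverO) (proj₁ ∘ coverI)
      (λ i → uniqueI _ _ i (proj₂ (coverO _)) (proj₂ (coverI i)))
      (λ o → uniqueO _ o _ (proj₂ (coverI _)) (proj₂ (coverO o)))

    partner-matched : ∀ {o i} → M o i → to partner o ≡ i
    partner-matched {o} {i} Moi = uniqueI o _ i (proj₂ (coverO o)) Moi

    partner-along : AlongG partner
    partner-along o = inB o _ (proj₂ (coverO o))

module _ {n} {inn out : Fin n → ℕ} (F : OVert out ↔ IVert inn) where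

  multiplicity : Fin n → Fin n → ℕ
  multiplicity u v = Σ[ (λ k → δ (proj₁ (to F (u , k))) v) ]

  -- In-degrees: transport the count along F to I, where it is Σ_{(w,j)} δ(w,v).
  multiplicity-in : ∀ v → Σ[ (λ u → multiplicity u v) ] ≡ inn v
  multiplicity-in v =
    trans (ΣΣ-bijection out inn F (λ i → δ (proj₁ i) v)) (ΣΣ-δ inn v)

  -- Out-degrees: each u^O_k lies over exactly one head vertex.
  multiplicity-out : ∀ u → Σ[ (λ v → multiplicity u v) ] ≡ out u
  multiplicity-out u = begin
    Σ[ (λ v → Σ[ (λ k → δ (target k) v) ]) ]   ≡⟨ ∑-comm (λ v k → δ (target k) v) ⟩
    Σ[ (λ k → Σ[ δ (target k) ]) ]             ≡⟨ sum-cong-≗ (Σ-δ-row ∘ target) ⟩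
    Σ[ (λ (_ : Fin (out u)) → 1) ]             ≡⟨ Σ-ones (out u) ⟩
    out u                                      ∎
    where
    open ≡-Reasoning
    target : Fin (out u) → Fin n
    target k = proj₁ (to F (u , k))

  multiplicity-witness : ∀ {u v} → Support multiplicity u v → ∃ λ k → proj₁ (to F (u , k)) ≡ v
  multiplicity-witness {u} {v} m≢0 with Σ≢0⇒term≢0 _ m≢0
  ... | k , δ≢0 = k , δ≢0⇒≡ _ v δ≢0

  multiplicity-pair : ∀ o → Support multiplicity (proj₁ o) (proj₁ (to F o))
  multiplicity-pair (u , k) m≡0 = 1+n≢0 (trans (sym (δ-diag _)) (Σ≡0⇒term≡0 _ m≡0 k))

matching⇒yes : ∀ {n} {G : Digraph n} {inn out} (PM : PerfectMatching G inn out) →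
               ConnectedMatching PM → YesInstance G inn out
matching⇒yes {G = G} PM connectedPM =
  m , inG , cutsCrossed⇒connected crossed , multiplicity-in F , multiplicity-out F
  where
  F = partner PM
  m = multiplicity F

  inG : ∀ u v → Support m u v → G u v
  inG u v m≢0 with multiplicity-witness F m≢0
  ... | k , Fk≡v = subst (G u) Fk≡v (partner-along PM (u , k))

  crossed : CutsCrossed (Support m)
  crossed X ne missed with connectedPM X ne missed
  ... | o , i , Moi , crosses = proj₁ o , proj₁ i , supported , crosses
    where
    supported : Support m (proj₁ o) (proj₁ i)
    supported = subst (Support m (proj₁ o) ∘ proj₁) (partner-matched PM Moi) (multiplicity-pair F o)

Σ-fibrewise : ∀ {A : Set} {B C : A → Set} → (∀ a → B a ↔ C a) → Σ A B ↔ Σ A C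
Σ-fibrewise f = mk↔ₛ′ (λ (a , b) → a , to (f a) b) (λ (a , c) → a , from (f a) c)
  (λ (a , c) → cong (a ,_) (strictlyInverseˡ (f a) c))
  (λ (a , b) → cong (a ,_) (strictlyInverseʳ (f a) b))

EdgeCopies : ∀ {n} → (Fin n → Fin n → ℕ) → Set
EdgeCopies {n} m = Σ (Fin n) λ u → Σ (Fin n) λ v → Fin (m u v)

module _ {n} {inn out : Fin n → ℕ} (m : Fin n → Fin n → ℕ)
         (inD : ∀ v → Σ[ (λ u → m u v) ] ≡ inn v)
         (outD : ∀ u → Σ[ (λ v → m u v) ] ≡ out u) where

  rowSplit : ∀ u → Fin (out u) ↔ Σ (Fin n) (λ v → Fin (m u v))
  rowSplit u = flattenTo (outD u)

  tails : OVert out ↔ EdgeCopies m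
  tails = Σ-fibrewise rowSplit

  columnSplit : ∀ v → Fin (inn v) ↔ Σ (Fin n) (λ u → Fin (m u v))
  columnSplit v = flattenTo (inD v)

  heads : IVert inn ↔ EdgeCopies m
  heads = ↔-trans (Σ-fibrewise columnSplit) (∃∃↔∃∃ (λ v u → Fin (m u v)))

  -- Send the tail of each edge copy to its head.
  copyMatch : OVert out ↔ IVert inn
  copyMatch = ↔-trans tails (↔-sym heads)

  -- Edge copies exist only on the support of m, hence only on edges of G.
  copyMatch-along : ∀ {G : Digraph n} → (∀ u v → Support m u v → G u v) → AlongG {G = G} copyMatch
  copyMatch-along supp (u , x) = supp u v (λ m≡0 → ¬Fin0 (subst Fin m≡0 k))
    where
    v = proj₁ (to (rowSplit u) x)
    k = proj₂ (to (rowSplit u) x)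

-- A yes-instance gives a connected perfect matching: the graph of copyMatch.
-- An edge (u,v) of the support crossing a cut lifts to a matched pair of copies of (u,v).
yes⇒matching : ∀ {n} {G : Digraph n} {inn out} →
               YesInstance G inn out → HasConnectedPerfectMatching G inn out
yes⇒matching (m , inG , connected , inD , outD) = PM , connectedPM
  where
  PM = graphMatching (copyMatch m inD outD) (copyMatch-along m inD outD inG)

  connectedPM : ConnectedMatching PM
  connectedPM X ne missed with connected⇒cutsCrossed connected X ne missed
  ... | u , v , m≢0 , crosses = from tails′ copy , from heads′ copy , matched , crosses
    where
    copy : EdgeCopies m
    copy = u , v , fromℕ< (n≢0⇒n>0 m≢0)
    tails′ = tails m inD outD
    heads′ = heads m inD outD
    -- copyMatch sends the tail of this copy to its head.
    matched : from heads′ (to tails′ (from tails′ copy)) ≡ from heads′ copy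
    matched = cong (from heads′) (strictlyInverseˡ tails′ copy)

lemma3 : ∀ (n : ℕ) (G : Digraph n) (inn out : Fin n → ℕ) →
           YesInstance G inn out ⇔ HasConnectedPerfectMatching G inn out
lemma3 n G inn out = mk⇔ yes⇒matching (λ (PM , connectedPM) → matching⇒yes PM connectedPM)
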